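{- There is a parameterized vector game $\mathcal{G}=(A,B,\mathcal{F})$ such that $\mathrm{Win}(\mathcal{G})$ does not have a cutoff with respect to $(\mathbb{N},\mathbb{N},\{0\})$.
   Context: $\mathbb{T}=\{s,e,se\}$. A parameterized vector game is $\mathcal{G}=(A,B,\mathcal{F})$ with $A=A_s\uplus A_e$ finite, $B\in\mathbb{N}$, locations $L=\{0,\dots,B\}^A$, and a finite set $\mathcal{F}\subseteq\mathfrak{C}^L$, where $\mathfrak{C}$ is the set of local acceptance conditions $(\bowtie_s n_s,\bowtie_e n_e,\bowtie_{se}n_{se})$ with $\bowtie_\theta\in\{=,\ge\}$, $n_\theta\in\mathbb{N}$. $\ell_0$ is the all-zero location; $(\ell+a)(a)=\min\{\ell(a)+1,B\}$, $(\ell+a)(b)=\ell(b)$ for $b\ne a$, extended to words. A configuration is $C:L\to\mathbb{N}^{\mathbb{T}}$. A system (resp. environment) transition is $\tau:L\times L\to\mathbb{N}\times\{0\}\times\mathbb{N}$ (resp. $\{0\}\times\mathbb{N}\times\mathbb{N}$) with $\tau(\ell,\ell')\ne(0,0,0)$ only if $\ell'=\ell+w$ for some $w\in A_s^*$ (resp. $A_e^*$). With $\mathrm{out}_\tau(\ell)=\sum_{\ell'}\tau(\ell,\ell')$, $\mathrm{in}_\tau(\ell)=\sum_{\ell'}\tau(\ell',\ell)$, $\tau$ is applicable at $C$ if $\mathrm{out}_\tau\le C$ componentwise, and $\tau(C)=C-\mathrm{out}_\tau+\mathrm{in}_\tau$. $C\models\mathcal{F}$ if some $\kappa\in\mathcal{F}$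 has $C(\ell)$ satisfying $\kappa(\ell)$ componentwise for all $\ell$. A $C$-play $C_0\tau_1C_1\dots\tau_nC_n$ has $C_0=C$, $C_i=\tau_i(C_{i-1})$, odd $i$: system transition and $C_i\models\mathcal{F}$; even $i$: environment transition and $C_i\not\models\mathcal{F}$. A $C$-strategy is a partial map $f$ from $C$-plays to system transitions, defined on $C$, returning only transitions applicable at the last configuration and leading to a configuration satisfying $\mathcal{F}$. Plays are $f$-compatible if odd moves follow $f$, $f$-maximal if not a strict prefix of an $f$-compatible play, winning if the last configuration satisfies $\mathcal{F}$; $f$ is winning if all $f$-compatible $f$-maximal $C$-plays are winning. $C_{\vec k}$ maps $\ell_0$ to $\vec k$ and other locations to $(0,0,0)$; $\mathrm{Win}(\mathcal{G})=\{\vec k\in\mathbb{N}^{\mathbb{T}}\mid C_{\vec k}$ is winning for System$\}$. For $W\subseteq\mathbb{N}^{\mathbb{T}}$ and $N_s,N_e,N_{se}\subseteq\mathbb{N}$, $\vec k_0$ is a cutoff of $W$ with respect to $(N_s,N_e,N_{se})$ if $\vec k_0\in N_s\times N_e\times N_{se}$ and either all $\vec k\in N_s\times N_e\times N_{se}$ with $\vec k\ge\vec k_0$ (componentwise) lie in $W$, or all such $\vec k$ lie outside $W$. -}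

module Defs where

open import Data.Nat using (ℕ; zero; suc; _+_; _∸_; _≤_; _⊓_; s≤s)
open import Data.Nat.Properties using (m⊓n≤n)
open import Data.Fin using (Fin; toℕ; fromℕ<) renaming (_≟_ to _≟F_)
open import Data.Vec using (Vec; []; _∷_; replicate; lookup; updateAt)
open import Data.Vec.Properties using (≡-dec)
open import Data.List using (List; []; _∷_; _++_; map; concatMap; allFin; foldr)
open import Data.List.Relation.Unary.All using (All)
open import Data.List.Relation.Unary.Any using (Any)
open import Data.Product using (Σ; _×_; _,_; ∃)
open import Data.Sum using (_⊎_)
open import Data.Maybe using (Maybe; just; nothing)
open import Data.Unit using (⊤)
open import Data.Empty using (⊥)
open import Relation.Nullary using (¬_; yes; no)
open import Relation.Binary.PropositionalEquality using (_≡_)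

-- Triples ℕ^𝕋, 𝕋 = {s, e, se}; a triple is (s-component , e-component , se-component)

Tri : Set
Tri = ℕ × ℕ × ℕ

zeroT : Tri
zeroT = 0 , 0 , 0

_+T_ : Tri → Tri → Tri
(a , b , c) +T (a' , b' , c') = (a + a') , (b + b') , (c + c')

_∸T_ : Tri → Tri → Tri
(a , b , c) ∸T (a' , b' , c') = (a ∸ a') , (b ∸ b') , (c ∸ c')

_≤T_ : Tri → Tri → Set
(a , b , c) ≤T (a' , b' , c') = (a ≤ a') × (b ≤ b') × (c ≤ c')

sumT : List Tri → Tri
sumT = foldr _+T_ zeroT

data Bowtie : Set where
  eq ge : Bowtie

satB : Bowtie → ℕ → ℕ → Set
satB eq n x = x ≡ n
satB ge n x = n ≤ x

Cond : Set
Cond = (Bowtie × ℕ) × (Bowtie × ℕ) × (Bowtie × ℕ)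

satC : Cond → Tri → Set
satC ((b₁ , n₁) , (b₂ , n₂) , (b₃ , n₃)) (x₁ , x₂ , x₃) =
  satB b₁ n₁ x₁ × satB b₂ n₂ x₂ × satB b₃ n₃ x₃

-- Players; A = A_s ⊎ A_e is given as Fin nA together with an owner map

data Player : Set where
  sys env : Player

Loc : ℕ → ℕ → Set
Loc nA B = Vec (Fin (suc B)) nA

-- all locations, each exactly once
allVecs : (n k : ℕ) → List (Vec (Fin k) n)
allVecs zero    k = [] ∷ []
allVecs (suc n) k = concatMap (λ i → map (i ∷_) (allVecs n k)) (allFin k)

incB : ∀ {B} → Fin (suc B) → Fin (suc B)
incB {B} i = fromℕ< {suc (toℕ i) ⊓ B} (s≤s (m⊓n≤n (suc (toℕ i)) B))

record Game : Set where
  field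
    nA    : ℕ
    owner : Fin nA → Player
    B     : ℕ
    F     : List (Loc nA B → Cond)

module _ (G : Game) where
  open Game G

  L : Set
  L = Loc nA B

  allL : List L
  allL = allVecs nA (suc B)

  ℓ₀ : L
  ℓ₀ = replicate nA Data.Fin.zero

  _+a_ : L → Fin nA → L
  ℓ +a a = updateAt ℓ a incB

  _+w_ : L → List (Fin nA) → L
  ℓ +w []      = ℓ
  ℓ +w (a ∷ w) = (ℓ +a a) +w w

  Config : Set
  Config = L → Tri

  Trans : Set
  Trans = L → L → Tri

  ReachBy : Player → L → L → Set
  ReachBy p ℓ ℓ' = Σ (List (Fin nA)) λ w → All (λ a → owner a ≡ p) w × (ℓ' ≡ ℓ +w w)

  IsSysTrans : Trans → Set
  IsSysTrans τ = ∀ ℓ ℓ' → (Data.Product.proj₁ (Data.Product.proj₂ (τ ℓ ℓ')) ≡ 0)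
                        × (¬ τ ℓ ℓ' ≡ zeroT → ReachBy sys ℓ ℓ')

  IsEnvTrans : Trans → Set
  IsEnvTrans τ = ∀ ℓ ℓ' → (Data.Product.proj₁ (τ ℓ ℓ') ≡ 0)
                        × (¬ τ ℓ ℓ' ≡ zeroT → ReachBy env ℓ ℓ')

  IsTransOf : Player → Trans → Set
  IsTransOf sys = IsSysTrans
  IsTransOf env = IsEnvTrans

  out : Trans → L → Tri
  out τ ℓ = sumT (map (τ ℓ) allL)

  inn : Trans → L → Tri
  inn τ ℓ = sumT (map (λ ℓ' → τ ℓ' ℓ) allL)

  Applicable : Trans → Config → Set
  Applicable τ C = ∀ ℓ → out τ ℓ ≤T C ℓ

  apply : Trans → Config → Config
  apply τ C ℓ = (C ℓ ∸T out τ ℓ) +T inn τ ℓ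

  _⊨F : Config → Set
  C ⊨F = Any (λ κ → ∀ ℓ → satC (κ ℓ) (C ℓ)) F

  flipP : Player → Player
  flipP sys = env
  flipP env = sys

  Accept : Player → Config → Set
  Accept sys C = C ⊨F
  Accept env C = ¬ (C ⊨F)

  -- A C-play C₀ τ₁ C₁ … τₙ Cₙ is represented by C together with [τ₁,…,τₙ];
  -- the configurations are determined by Cᵢ = τᵢ(Cᵢ₋₁).
  PlayFrom : Player → Config → List Trans → Set
  PlayFrom p C []       = ⊤
  PlayFrom p C (τ ∷ ts) = IsTransOf p τ × Applicable τ C × Accept p (apply τ C)
                        × PlayFrom (flipP p) (apply τ C) ts

  IsPlay : Config → List Trans → Set
  IsPlay C ts = PlayFrom sys C ts

  lastConf : Config → List Trans → Config
  lastConf C []       = C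
  lastConf C (τ ∷ ts) = lastConf (apply τ C) ts

  _≈τ_ : Trans → Trans → Set
  τ ≈τ τ' = ∀ ℓ ℓ' → τ ℓ ℓ' ≡ τ' ℓ ℓ'

  data _≈P_ : List Trans → List Trans → Set where
    []  : [] ≈P []
    _∷_ : ∀ {τ τ' ts ts'} → τ ≈τ τ' → ts ≈P ts' → (τ ∷ ts) ≈P (τ' ∷ ts')

  data _≈M_ : Maybe Trans → Maybe Trans → Set where
    nothing : nothing ≈M nothing
    just    : ∀ {τ τ'} → τ ≈τ τ' → just τ ≈M just τ'

  PreStrategy : Set
  PreStrategy = List Trans → Maybe Trans

  IsStrategy : Config → PreStrategy → Set
  IsStrategy C f =
      (Σ Trans λ τ → f [] ≡ just τ)
    × (∀ ts τ → IsPlay C ts → f ts ≡ just τ →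
         IsSysTrans τ × Applicable τ (lastConf C ts) × (apply τ (lastConf C ts) ⊨F))
    × (∀ ts ts' → IsPlay C ts → IsPlay C ts' → ts ≈P ts' → f ts ≈M f ts')

  CompatFrom : PreStrategy → Player → List Trans → List Trans → Set
  CompatFrom f p hist []       = ⊤
  CompatFrom f sys hist (τ ∷ ts) = (Σ Trans λ τ' → f hist ≡ just τ' × τ' ≈τ τ)
                                 × CompatFrom f env (hist ++ (τ ∷ [])) ts
  CompatFrom f env hist (τ ∷ ts) = CompatFrom f sys (hist ++ (τ ∷ [])) ts

  Compatible : PreStrategy → List Trans → Set
  Compatible f ts = CompatFrom f sys [] ts

  Maximal : Config → PreStrategy → List Trans → Set
  Maximal C f ts = ∀ u us → IsPlay C (ts ++ (u ∷ us)) → ¬ Compatible f (ts ++ (u ∷ us))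

  IsWinningStrategy : Config → PreStrategy → Set
  IsWinningStrategy C f = IsStrategy C f ×
    (∀ ts → IsPlay C ts → Compatible f ts → Maximal C f ts → lastConf C ts ⊨F)

  WinningConfig : Config → Set
  WinningConfig C = Σ PreStrategy λ f → IsWinningStrategy C f

  Cinit : Tri → Config
  Cinit k ℓ with ≡-dec _≟F_ ℓ ℓ₀
  ... | yes _ = k
  ... | no  _ = zeroT

  Win : Tri → Set
  Win k = WinningConfig (Cinit k)

IsCutoff : (W : Tri → Set) (Ns Ne Nse : ℕ → Set) → Tri → Set
IsCutoff W Ns Ne Nse (a , b , c) =
  (Ns a × Ne b × Nse c) ×
  ( (∀ x y z → Ns x → Ne y → Nse z → a ≤ x → b ≤ y → c ≤ z → W (x , y , z))
  ⊎ (∀ x y z → Ns x → Ne y → Nse z → a ≤ x → b ≤ y → c ≤ z → ¬ W (x , y , z)))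

Allℕ : ℕ → Set
Allℕ _ = ⊤

Only0 : ℕ → Set
Only0 n = n ≡ 0

-- The game has one system letter and one environment letter and bound 2; 𝓕 accepts exactly
-- when the system tokens on ℓ₁₀ and the environment tokens on ℓ₀₁ are both absent or both present.
-- Tokens only ever move to larger locations. So whenever Environment pushes a token from ℓ₀₀ to
-- ℓ₀₁, System has to answer by pushing one of its own tokens from ℓ₀₀ to ℓ₁₀, and once Environment
-- moves its tokens on to ℓ₀₂, System has to empty ℓ₁₀ again. Starting from (k_s, k_e, 0), System
-- therefore wins iff k_e ≤ k_s: with enough tokens it keeps the invariant Safe, and otherwise
-- Environment repeats such rounds, each of which lowers System's count on ℓ₀₀ while keeping it
-- below Environment's, until System cannot answer. Above every triple there are both winning
-- and losing ones, so Win has no cutoff.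
module Submission where

open import Defs
open import Data.Nat using (ℕ; zero; suc; _+_; _∸_; _≤_; _<_; z≤n; s≤s; _≟_)
open import Data.Nat.Properties
open import Data.Fin using (Fin; zero; suc; toℕ)
import Data.Fin as Fin
import Data.Fin.Properties as Fin
open import Data.Fin.Patterns using (0F; 1F; 2F)
open import Data.Vec using ([]; _∷_; updateAt)
open import Data.Vec.Relation.Binary.Pointwise.Inductive as Pointwise using (Pointwise; []; _∷_)
import Data.Vec.Properties as Vec
open import Data.List using (List; []; _∷_; _++_; map; drop)
open import Data.List.Membership.Propositional using (_∈_)
open import Data.List.Properties using (++-identityʳ; ++-assoc; map-cong)
open import Data.List.Relation.Unary.All using ([]; _∷_)
open import Data.List.Relation.Unary.Any using (here; there)
open import Data.Maybe using (Maybe; just; nothing)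
open import Data.Product using (Σ; _×_; _,_; proj₁; proj₂)
import Data.Product.Properties as Product
open import Data.Sum using (inj₁; inj₂)
open import Data.Unit using (tt)
open import Data.Empty using (⊥; ⊥-elim)
open import Relation.Nullary using (¬_; Dec; yes; no; contradiction)
open import Relation.Nullary.Decidable using (False; toWitnessFalse; decidable-stable)
open import Relation.Binary.PropositionalEquality
open import Algebra.Properties.CommutativeSemigroup +-commutativeSemigroup using (interchange)

_≟T_ : (x y : Tri) → Dec (x ≡ y)
_≟T_ = Product.≡-dec _≟_ (Product.≡-dec _≟_ _≟_)

drain-≤ : ∀ {c o i} → o ≤ c → i ≤ o → c ∸ o + i ≤ c
drain-≤ {c} {o} o≤c i≤o = ≤-trans (+-monoʳ-≤ (c ∸ o) i≤o) (≤-reflexive (m∸n+n≡m o≤c))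

drain₂-≤ : ∀ {c₀ c₁ o₀ o₁ i₀ i₁} → o₀ ≤ c₀ → o₁ ≤ c₁ → i₀ + i₁ ≤ o₀ + o₁ →
           (c₀ ∸ o₀ + i₀) + (c₁ ∸ o₁ + i₁) ≤ c₀ + c₁
drain₂-≤ {c₀} {c₁} {o₀} {o₁} {i₀} {i₁} o₀≤c₀ o₁≤c₁ i≤o = begin
  (c₀ ∸ o₀ + i₀) + (c₁ ∸ o₁ + i₁)   ≡⟨ interchange (c₀ ∸ o₀) i₀ (c₁ ∸ o₁) i₁ ⟩
  (c₀ ∸ o₀ + (c₁ ∸ o₁)) + (i₀ + i₁) ≤⟨ +-monoʳ-≤ (c₀ ∸ o₀ + (c₁ ∸ o₁)) i≤o ⟩
  (c₀ ∸ o₀ + (c₁ ∸ o₁)) + (o₀ + o₁) ≡⟨ interchange (c₀ ∸ o₀) (c₁ ∸ o₁) o₀ o₁ ⟩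
  (c₀ ∸ o₀ + o₀) + (c₁ ∸ o₁ + o₁)   ≡⟨ cong₂ _+_ (m∸n+n≡m o₀≤c₀) (m∸n+n≡m o₁≤c₁) ⟩
  c₀ + c₁                           ∎
  where open ≤-Reasoning

flow-pair-≤ : ∀ {t a A d D} → a ≤ A → d ≤ D → (t + 0) + (a + (d + 0)) ≤ (t + A) + D
flow-pair-≤ {t} {a} {A} {d} {D} a≤A d≤D = begin
  (t + 0) + (a + (d + 0)) ≡⟨ cong₂ _+_ (+-identityʳ t) (cong (a +_) (+-identityʳ d)) ⟩
  t + (a + d)             ≡⟨ +-assoc t a d ⟨
  (t + a) + d             ≤⟨ +-mono-≤ (+-monoʳ-≤ t a≤A) d≤D ⟩
  (t + A) + D             ∎
  where open ≤-Reasoning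

drain-≤T : ∀ {c o i} → o ≤T c → i ≤T o → ((c ∸T o) +T i) ≤T c
drain-≤T (p₁ , p₂ , p₃) (q₁ , q₂ , q₃) = drain-≤ p₁ q₁ , drain-≤ p₂ q₂ , drain-≤ p₃ q₃

drain₂-≤T : ∀ {c₀ c₁ o₀ o₁ i₀ i₁} → o₀ ≤T c₀ → o₁ ≤T c₁ → (i₀ +T i₁) ≤T (o₀ +T o₁) →
            (((c₀ ∸T o₀) +T i₀) +T ((c₁ ∸T o₁) +T i₁)) ≤T (c₀ +T c₁)
drain₂-≤T (p₁ , p₂ , p₃) (q₁ , q₂ , q₃) (r₁ , r₂ , r₃) =
  drain₂-≤ p₁ q₁ r₁ , drain₂-≤ p₂ q₂ r₂ , drain₂-≤ p₃ q₃ r₃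

flow-pair-≤T : ∀ t a d {A D} → a ≤T A → d ≤T D →
               ((t +T zeroT) +T (a +T (d +T zeroT))) ≤T ((t +T A) +T D)
flow-pair-≤T t a d (p₁ , p₂ , p₃) (q₁ , q₂ , q₃) =
  flow-pair-≤ {proj₁ t} p₁ q₁ , flow-pair-≤ {proj₁ (proj₂ t)} p₂ q₂ , flow-pair-≤ {proj₂ (proj₂ t)} p₃ q₃

zeroT-≤T : ∀ {t} → zeroT ≤T t
zeroT-≤T = z≤n , z≤n , z≤n

≤T-+T-right : ∀ x y → x ≤T (x +T y)
≤T-+T-right (x₁ , x₂ , x₃) (y₁ , y₂ , y₃) = m≤m+n x₁ y₁ , m≤m+n x₂ y₂ , m≤m+n x₃ y₃

≤T-+T-left : ∀ {x y} z → x ≤T y → x ≤T (z +T y)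
≤T-+T-left (z₁ , z₂ , z₃) (p₁ , p₂ , p₃) = m≤n⇒m≤o+n z₁ p₁ , m≤n⇒m≤o+n z₂ p₂ , m≤n⇒m≤o+n z₃ p₃

member-≤T : ∀ {A : Set} (g : A → Tri) {x} xs → x ∈ xs → g x ≤T sumT (map g xs)
member-≤T g (y ∷ ys) (here refl)  = ≤T-+T-right (g y) (sumT (map g ys))
member-≤T g (y ∷ ys) (there x∈ys) = ≤T-+T-left (g y) (member-≤T g ys x∈ys)

_≼_ : ∀ {n B} → Loc n B → Loc n B → Set
_≼_ = Pointwise Fin._≤_

_≼?_ : ∀ {n B} (ℓ ℓ' : Loc n B) → Dec (ℓ ≼ ℓ')
_≼?_ = Pointwise.decidable Fin._≤?_

incB-increasing : ∀ {B} (i : Fin (suc B)) → i Fin.≤ incB i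
incB-increasing {B} i =
  subst (toℕ i ≤_) (sym (Fin.toℕ-fromℕ< _)) (⊓-glb (n≤1+n (toℕ i)) (Fin.toℕ≤pred[n] i))

updateAt-incB-increasing : ∀ {n B} (ℓ : Loc n B) a → ℓ ≼ updateAt ℓ a incB
updateAt-incB-increasing (i ∷ ℓ) zero    = incB-increasing i ∷ Pointwise.refl Fin.≤-refl
updateAt-incB-increasing (i ∷ ℓ) (suc a) = Fin.≤-refl ∷ updateAt-incB-increasing ℓ a

-- the coordinate of the opponent of p, which moves of p leave untouched
foreign : Player → Tri → ℕ
foreign sys t = proj₁ (proj₂ t)
foreign env t = proj₁ t

foreign-+T : ∀ p x y → foreign p (x +T y) ≡ foreign p x + foreign p y
foreign-+T sys x y = refl
foreign-+T env x y = refl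

foreign-∸T : ∀ p x y → foreign p (x ∸T y) ≡ foreign p x ∸ foreign p y
foreign-∸T sys x y = refl
foreign-∸T env x y = refl

LegalSysMove : (𝒢 : Game) → Config 𝒢 → Trans 𝒢 → Set
LegalSysMove 𝒢 C τ = IsSysTrans 𝒢 τ × Applicable 𝒢 τ C × _⊨F 𝒢 (apply 𝒢 τ C)

module Properties (𝒢 : Game) where

  _≟L_ : (ℓ ℓ' : L 𝒢) → Dec (ℓ ≡ ℓ')
  _≟L_ = Vec.≡-dec Fin._≟_

  +w-increasing : ∀ ℓ w → ℓ ≼ _+w_ 𝒢 ℓ w
  +w-increasing ℓ []      = Pointwise.refl Fin.≤-refl
  +w-increasing ℓ (a ∷ w) = Pointwise.trans Fin.≤-trans (updateAt-incB-increasing ℓ a) (+w-increasing _ w)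

  reachBy-increasing : ∀ {p ℓ ℓ'} → ReachBy 𝒢 p ℓ ℓ' → ℓ ≼ ℓ'
  reachBy-increasing (w , _ , refl) = +w-increasing _ w

  foreign-untouched : ∀ {p τ} → IsTransOf 𝒢 p τ → ∀ ℓ ℓ' → foreign p (τ ℓ ℓ') ≡ 0
  foreign-untouched {sys} τ-valid ℓ ℓ' = proj₁ (τ-valid ℓ ℓ')
  foreign-untouched {env} τ-valid ℓ ℓ' = proj₁ (τ-valid ℓ ℓ')

  nonzero⇒reachBy : ∀ {p τ ℓ ℓ'} → IsTransOf 𝒢 p τ → ¬ τ ℓ ℓ' ≡ zeroT → ReachBy 𝒢 p ℓ ℓ'
  nonzero⇒reachBy {sys} τ-valid = proj₂ (τ-valid _ _)
  nonzero⇒reachBy {env} τ-valid = proj₂ (τ-valid _ _)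

  moves-up : ∀ {p τ} → IsTransOf 𝒢 p τ → ∀ {ℓ ℓ'} → ¬ ℓ ≼ ℓ' → τ ℓ ℓ' ≡ zeroT
  moves-up {p} {τ} τ-valid {ℓ} {ℓ'} ℓ⋠ℓ' = decidable-stable (τ ℓ ℓ' ≟T zeroT)
    λ τ≢0 → ℓ⋠ℓ' (reachBy-increasing (nonzero⇒reachBy {p} {τ} τ-valid τ≢0))

  foreign-sumT : ∀ p (g : L 𝒢 → Tri) xs → (∀ x → foreign p (g x) ≡ 0) → foreign p (sumT (map g xs)) ≡ 0
  foreign-sumT sys g [] g≡0 = refl
  foreign-sumT env g [] g≡0 = refl
  foreign-sumT p g (x ∷ xs) g≡0 =
    trans (foreign-+T p (g x) _) (cong₂ _+_ (g≡0 x) (foreign-sumT p g xs g≡0))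

  keeps-foreign : ∀ {p τ} → IsTransOf 𝒢 p τ → ∀ C ℓ → foreign p (apply 𝒢 τ C ℓ) ≡ foreign p (C ℓ)
  keeps-foreign {p} {τ} τ-valid C ℓ = begin
    foreign p (apply 𝒢 τ C ℓ)
      ≡⟨ foreign-+T p (C ℓ ∸T out 𝒢 τ ℓ) (inn 𝒢 τ ℓ) ⟩
    foreign p (C ℓ ∸T out 𝒢 τ ℓ) + foreign p (inn 𝒢 τ ℓ)
      ≡⟨ cong₂ _+_ (foreign-∸T p (C ℓ) (out 𝒢 τ ℓ))
                   (foreign-sumT p _ (allL 𝒢) (λ ℓ' → foreign-untouched {p} {τ} τ-valid ℓ' ℓ)) ⟩
    foreign p (C ℓ) ∸ foreign p (out 𝒢 τ ℓ) + 0
      ≡⟨ cong (λ o → foreign p (C ℓ) ∸ o + 0) (foreign-sumT p _ (allL 𝒢) (foreign-untouched {p} {τ} τ-valid ℓ)) ⟩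
    foreign p (C ℓ) + 0
      ≡⟨ +-identityʳ _ ⟩
    foreign p (C ℓ) ∎
    where open ≡-Reasoning

  move : L 𝒢 → L 𝒢 → Tri → Trans 𝒢
  move a b v ℓ ℓ' with ℓ ≟L a | ℓ' ≟L b
  ... | yes _ | yes _ = v
  ... | _     | _     = zeroT

  move-shape : ∀ (P : Tri → Set) (R : L 𝒢 → L 𝒢 → Set) {a b v} → P zeroT → P v → R a b →
               ∀ ℓ ℓ' → P (move a b v ℓ ℓ') × (¬ move a b v ℓ ℓ' ≡ zeroT → R ℓ ℓ')
  move-shape P R {a} {b} p₀ pᵥ r ℓ ℓ' with ℓ ≟L a | ℓ' ≟L b
  ... | yes refl | yes refl = pᵥ , λ _ → r
  ... | yes _    | no _     = p₀ , λ 0≢0 → ⊥-elim (0≢0 refl)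
  ... | no _     | _        = p₀ , λ 0≢0 → ⊥-elim (0≢0 refl)

  move-valid : ∀ p {a b v} → ReachBy 𝒢 p a b → foreign p v ≡ 0 → IsTransOf 𝒢 p (move a b v)
  move-valid sys r v-untouched = move-shape (λ t → foreign sys t ≡ 0) (ReachBy 𝒢 sys) refl v-untouched r
  move-valid env r v-untouched = move-shape (λ t → foreign env t ≡ 0) (ReachBy 𝒢 env) refl v-untouched r

  _≈C_ : Config 𝒢 → Config 𝒢 → Set
  C ≈C C' = ∀ ℓ → C ℓ ≡ C' ℓ

  apply-cong : ∀ {τ τ' C C'} → _≈τ_ 𝒢 τ τ' → C ≈C C' → apply 𝒢 τ C ≈C apply 𝒢 τ' C'
  apply-cong τ≈τ' C≈C' ℓ =
    cong₂ _+T_ (cong₂ _∸T_ (C≈C' ℓ) (cong sumT (map-cong (τ≈τ' ℓ) (allL 𝒢))))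
               (cong sumT (map-cong (λ ℓ' → τ≈τ' ℓ' ℓ) (allL 𝒢)))

  lastConf-cong : ∀ {ts ts' C C'} → _≈P_ 𝒢 ts ts' → C ≈C C' → lastConf 𝒢 C ts ≈C lastConf 𝒢 C' ts'
  lastConf-cong []         C≈C' = C≈C'
  lastConf-cong (τ≈τ' ∷ ts≈ts') C≈C' = lastConf-cong ts≈ts' (apply-cong τ≈τ' C≈C')

  lastConf-++ : ∀ C ts us → lastConf 𝒢 C (ts ++ us) ≡ lastConf 𝒢 (lastConf 𝒢 C ts) us
  lastConf-++ C []       us = refl
  lastConf-++ C (τ ∷ ts) us = lastConf-++ (apply 𝒢 τ C) ts us

  turn : Player → List (Trans 𝒢) → Player
  turn p []       = p
  turn p (_ ∷ ts) = turn (flipP 𝒢 p) ts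

  turn-++ : ∀ p ts us → turn p (ts ++ us) ≡ turn (turn p ts) us
  turn-++ p []       us = refl
  turn-++ p (τ ∷ ts) us = turn-++ (flipP 𝒢 p) ts us

  PlayFrom-++ : ∀ p C ts us → PlayFrom 𝒢 p C ts → PlayFrom 𝒢 (turn p ts) (lastConf 𝒢 C ts) us →
                PlayFrom 𝒢 p C (ts ++ us)
  PlayFrom-++ p C []       us _ us-play = us-play
  PlayFrom-++ p C (τ ∷ ts) us (τ-valid , τ-app , τ-acc , ts-play) us-play =
    τ-valid , τ-app , τ-acc , PlayFrom-++ (flipP 𝒢 p) (apply 𝒢 τ C) ts us ts-play us-play

  CompatFrom-++ : ∀ f p h ts us → CompatFrom 𝒢 f p h ts → CompatFrom 𝒢 f (turn p ts) (h ++ ts) us →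
                  CompatFrom 𝒢 f p h (ts ++ us)
  CompatFrom-++ f p h [] us _ us-compat = subst (λ h' → CompatFrom 𝒢 f p h' us) (++-identityʳ h) us-compat
  CompatFrom-++ f sys h (τ ∷ ts) us (τ-by-f , ts-compat) us-compat =
    τ-by-f , CompatFrom-++ f env (h ++ τ ∷ []) ts us ts-compat
               (subst (λ h' → CompatFrom 𝒢 f (turn env ts) h' us) (sym (++-assoc h (τ ∷ []) ts)) us-compat)
  CompatFrom-++ f env h (τ ∷ ts) us ts-compat us-compat =
    CompatFrom-++ f sys (h ++ τ ∷ []) ts us ts-compat
      (subst (λ h' → CompatFrom 𝒢 f (turn sys ts) h' us) (sym (++-assoc h (τ ∷ []) ts)) us-compat)

  CompatFrom-++⁻ : ∀ f p h ts us → CompatFrom 𝒢 f p h (ts ++ us) → CompatFrom 𝒢 f (turn p ts) (h ++ ts) us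
  CompatFrom-++⁻ f p h [] us compat = subst (λ h' → CompatFrom 𝒢 f p h' us) (sym (++-identityʳ h)) compat
  CompatFrom-++⁻ f sys h (τ ∷ ts) us (_ , compat) =
    subst (λ h' → CompatFrom 𝒢 f (turn env ts) h' us) (++-assoc h (τ ∷ []) ts)
      (CompatFrom-++⁻ f env (h ++ τ ∷ []) ts us compat)
  CompatFrom-++⁻ f env h (τ ∷ ts) us compat =
    subst (λ h' → CompatFrom 𝒢 f (turn sys ts) h' us) (++-assoc h (τ ∷ []) ts)
      (CompatFrom-++⁻ f sys (h ++ τ ∷ []) ts us compat)

  ≈M-reflexive : ∀ {m m'} → m ≡ m' → _≈M_ 𝒢 m m'
  ≈M-reflexive {nothing} refl = nothing
  ≈M-reflexive {just τ}  refl = just (λ _ _ → refl)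

  lastConf-snoc-cong : ∀ C₀ h {D} τ → lastConf 𝒢 C₀ h ≈C D → lastConf 𝒢 C₀ (h ++ τ ∷ []) ≈C apply 𝒢 τ D
  lastConf-snoc-cong C₀ h τ h≈D ℓ =
    trans (cong (λ C → C ℓ) (lastConf-++ C₀ h (τ ∷ []))) (apply-cong {τ} {τ} (λ _ _ → refl) h≈D ℓ)

  last-accepted : ∀ p C τ ts → PlayFrom 𝒢 p C (τ ∷ ts) →
                  Accept 𝒢 (flipP 𝒢 (turn p (τ ∷ ts))) (lastConf 𝒢 C (τ ∷ ts))
  last-accepted sys C τ []        (_ , _ , τC-acc , _) = τC-acc
  last-accepted env C τ []        (_ , _ , τC-acc , _) = τC-acc
  last-accepted sys C τ (τ' ∷ ts) (_ , _ , _ , rest)   = last-accepted env (apply 𝒢 τ C) τ' ts rest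
  last-accepted env C τ (τ' ∷ ts) (_ , _ , _ , rest)   = last-accepted sys (apply 𝒢 τ C) τ' ts rest

  module _ (C₀ : Config 𝒢) (f : PreStrategy 𝒢) where

    extend-by-sys : ∀ {ts σ} → IsPlay 𝒢 C₀ ts → Compatible 𝒢 f ts → turn sys ts ≡ sys → f ts ≡ just σ →
                    LegalSysMove 𝒢 (lastConf 𝒢 C₀ ts) σ →
                    IsPlay 𝒢 C₀ (ts ++ σ ∷ []) × Compatible 𝒢 f (ts ++ σ ∷ [])
    extend-by-sys {ts} {σ} ts-play ts-compat sys-turn f≡σ (σ-valid , σ-app , σ-acc) =
      PlayFrom-++ sys C₀ ts (σ ∷ []) ts-play
        (subst (λ p → PlayFrom 𝒢 p (lastConf 𝒢 C₀ ts) (σ ∷ [])) (sym sys-turn) (σ-valid , σ-app , σ-acc , tt)) ,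
      CompatFrom-++ f sys [] ts (σ ∷ []) ts-compat
        (subst (λ p → CompatFrom 𝒢 f p ts (σ ∷ [])) (sym sys-turn) ((σ , f≡σ , λ _ _ → refl) , tt))

    extend-by-env : ∀ {ts ρ} → IsPlay 𝒢 C₀ ts → Compatible 𝒢 f ts → turn sys ts ≡ env →
                    IsEnvTrans 𝒢 ρ → Applicable 𝒢 ρ (lastConf 𝒢 C₀ ts) → ¬ _⊨F 𝒢 (apply 𝒢 ρ (lastConf 𝒢 C₀ ts)) →
                    IsPlay 𝒢 C₀ (ts ++ ρ ∷ []) × Compatible 𝒢 f (ts ++ ρ ∷ [])
    extend-by-env {ts} {ρ} ts-play ts-compat env-turn ρ-valid ρ-app ρ-rejected =
      PlayFrom-++ sys C₀ ts (ρ ∷ []) ts-play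
        (subst (λ p → PlayFrom 𝒢 p (lastConf 𝒢 C₀ ts) (ρ ∷ [])) (sym env-turn) (ρ-valid , ρ-app , ρ-rejected , tt)) ,
      CompatFrom-++ f sys [] ts (ρ ∷ []) ts-compat
        (subst (λ p → CompatFrom 𝒢 f p ts (ρ ∷ [])) (sym env-turn) tt)

    undefined⇒maximal : ∀ {ts} → turn sys ts ≡ sys → f ts ≡ nothing → Maximal 𝒢 C₀ f ts
    undefined⇒maximal {ts} sys-turn f≡nothing u us _ compat
      with subst (λ p → CompatFrom 𝒢 f p ts (u ∷ us)) sys-turn (CompatFrom-++⁻ f sys [] ts (u ∷ us) compat)
    ... | (_ , f≡just , _) , _ with trans (sym f≡nothing) f≡just
    ... | ()

  module Positional (C₀ : Config 𝒢) (respond : Config 𝒢 → Maybe (Trans 𝒢)) (Inv : Config 𝒢 → Set)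
    (respond-cong : ∀ {C C'} → C ≈C C' → respond C ≡ respond C')
    (Inv-cong : ∀ {C C'} → C ≈C C' → Inv C → Inv C')
    (respond-legal : ∀ C {σ} → respond C ≡ just σ → LegalSysMove 𝒢 C σ)
    (respond-defined : ∀ C → Inv C → Σ (Trans 𝒢) λ σ → respond C ≡ just σ)
    (respond-preserves : ∀ C {σ} → Inv C → respond C ≡ just σ → Inv (apply 𝒢 σ C))
    (env-preserves : ∀ C {ρ} → IsEnvTrans 𝒢 ρ → Applicable 𝒢 ρ C → Inv C → Inv (apply 𝒢 ρ C))
    (Inv₀ : Inv C₀) where

    strategy : PreStrategy 𝒢
    strategy ts = respond (lastConf 𝒢 C₀ ts)

    Inv-along : ∀ p D ts h → PlayFrom 𝒢 p D ts → CompatFrom 𝒢 strategy p h ts →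
                lastConf 𝒢 C₀ h ≈C D → Inv D → Inv (lastConf 𝒢 D ts)
    Inv-along p D [] h _ _ _ inv = inv
    Inv-along sys D (τ ∷ ts) h (_ , _ , _ , ts-play) ((σ , σ-chosen , σ≈τ) , ts-compat) h≈D inv =
      Inv-along env (apply 𝒢 τ D) ts (h ++ τ ∷ []) ts-play ts-compat (lastConf-snoc-cong C₀ h τ h≈D)
        (Inv-cong (apply-cong σ≈τ (λ _ → refl)) (respond-preserves D inv (trans (sym (respond-cong h≈D)) σ-chosen)))
    Inv-along env D (τ ∷ ts) h (τ-valid , τ-app , _ , ts-play) ts-compat h≈D inv =
      Inv-along sys (apply 𝒢 τ D) ts (h ++ τ ∷ []) ts-play ts-compat (lastConf-snoc-cong C₀ h τ h≈D)
        (env-preserves D τ-valid τ-app inv)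

    strategy-valid : IsStrategy 𝒢 C₀ strategy
    strategy-valid =
      respond-defined C₀ Inv₀ ,
      (λ _ _ _ → respond-legal _) ,
      λ _ _ _ _ ts≈ts' → ≈M-reflexive (respond-cong (lastConf-cong ts≈ts' (λ _ → refl)))

    maximal⇒env-turn : ∀ ts → IsPlay 𝒢 C₀ ts → Compatible 𝒢 strategy ts → Maximal 𝒢 C₀ strategy ts →
                       turn sys ts ≡ env
    maximal⇒env-turn ts ts-play ts-compat maximal with turn sys ts in turn≡
    ... | env = refl
    ... | sys with respond-defined _ (Inv-along sys C₀ ts [] ts-play ts-compat (λ _ → refl) Inv₀)
    ... | σ , σ-chosen with extend-by-sys C₀ strategy ts-play ts-compat turn≡ σ-chosen (respond-legal _ σ-chosen)
    ... | extended-play , extended-compat = ⊥-elim (maximal σ [] extended-play extended-compat)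

    positional-wins : WinningConfig 𝒢 C₀
    positional-wins = strategy , strategy-valid , ends-accepted
      where
      ends-accepted : ∀ ts → IsPlay 𝒢 C₀ ts → Compatible 𝒢 strategy ts → Maximal 𝒢 C₀ strategy ts →
                      _⊨F 𝒢 (lastConf 𝒢 C₀ ts)
      ends-accepted [] ts-play ts-compat maximal with maximal⇒env-turn [] ts-play ts-compat maximal
      ... | ()
      ends-accepted (τ ∷ ts) ts-play ts-compat maximal =
        subst (λ p → Accept 𝒢 (flipP 𝒢 p) (lastConf 𝒢 C₀ (τ ∷ ts)))
              (maximal⇒env-turn (τ ∷ ts) ts-play ts-compat maximal) (last-accepted sys C₀ τ ts ts-play)

  module ForcedReplies {C₀ : Config 𝒢} {f : PreStrategy 𝒢} (f-wins : IsWinningStrategy 𝒢 C₀ f) where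

    record EnvToMove (ts : List (Trans 𝒢)) : Set where
      field
        isPlay     : IsPlay 𝒢 C₀ ts
        compatible : Compatible 𝒢 f ts
        envTurn    : turn sys ts ≡ env

    defined-when-rejected : ∀ {ts} → IsPlay 𝒢 C₀ ts → Compatible 𝒢 f ts → turn sys ts ≡ sys →
                            ¬ _⊨F 𝒢 (lastConf 𝒢 C₀ ts) → Σ (Trans 𝒢) λ σ → f ts ≡ just σ
    defined-when-rejected {ts} ts-play ts-compat sys-turn rejected with f ts in f≡
    ... | just σ  = σ , refl
    ... | nothing = ⊥-elim (rejected (proj₂ f-wins ts ts-play ts-compat (undefined⇒maximal C₀ f sys-turn f≡)))

    opening : Σ (Trans 𝒢) λ σ → LegalSysMove 𝒢 C₀ σ × EnvToMove (σ ∷ [])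
    opening = σ , legal , record
      { isPlay = proj₁ legal , proj₁ (proj₂ legal) , proj₂ (proj₂ legal) , tt
      ; compatible = (σ , f[]≡σ , λ _ _ → refl) , tt
      ; envTurn = refl
      }
      where
      σ = proj₁ (proj₁ (proj₁ f-wins))
      f[]≡σ = proj₂ (proj₁ (proj₁ f-wins))
      legal = proj₁ (proj₂ (proj₁ f-wins)) [] σ tt f[]≡σ

    forced-reply : ∀ {ts ρ} → EnvToMove ts → IsEnvTrans 𝒢 ρ → Applicable 𝒢 ρ (lastConf 𝒢 C₀ ts) →
                   ¬ _⊨F 𝒢 (apply 𝒢 ρ (lastConf 𝒢 C₀ ts)) →
                   Σ (Trans 𝒢) λ σ → LegalSysMove 𝒢 (apply 𝒢 ρ (lastConf 𝒢 C₀ ts)) σ × EnvToMove (ts ++ ρ ∷ σ ∷ [])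
    forced-reply {ts} {ρ} ts-env ρ-valid ρ-app ρ-rejected =
      σ , legal , subst EnvToMove (++-assoc ts (ρ ∷ []) (σ ∷ [])) record
        { isPlay = proj₁ extended₂ ; compatible = proj₂ extended₂
        ; envTurn = trans (turn-++ sys ts₁ (σ ∷ [])) (cong (λ p → turn p (σ ∷ [])) sys-turn₁) }
      where
      open EnvToMove ts-env
      ts₁ = ts ++ ρ ∷ []
      last₁ : lastConf 𝒢 C₀ ts₁ ≡ apply 𝒢 ρ (lastConf 𝒢 C₀ ts)
      last₁ = lastConf-++ C₀ ts (ρ ∷ [])
      extended₁ = extend-by-env C₀ f isPlay compatible envTurn ρ-valid ρ-app ρ-rejected
      sys-turn₁ : turn sys ts₁ ≡ sys
      sys-turn₁ = trans (turn-++ sys ts (ρ ∷ [])) (cong (λ p → turn p (ρ ∷ [])) envTurn)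
      reply = defined-when-rejected (proj₁ extended₁) (proj₂ extended₁) sys-turn₁
                (subst (λ C → ¬ _⊨F 𝒢 C) (sym last₁) ρ-rejected)
      σ = proj₁ reply
      legal₁ : LegalSysMove 𝒢 (lastConf 𝒢 C₀ ts₁) σ
      legal₁ = proj₁ (proj₂ (proj₁ f-wins)) ts₁ σ (proj₁ extended₁) (proj₂ reply)
      legal : LegalSysMove 𝒢 (apply 𝒢 ρ (lastConf 𝒢 C₀ ts)) σ
      legal = subst (λ C → LegalSysMove 𝒢 C σ) last₁ legal₁
      extended₂ = extend-by-sys C₀ f (proj₁ extended₁) (proj₂ extended₁) sys-turn₁ (proj₂ reply) legal₁

pattern ℓ₀₀ = 0F ∷ 0F ∷ []
pattern ℓ₀₁ = 0F ∷ 1F ∷ []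
pattern ℓ₀₂ = 0F ∷ 2F ∷ []
pattern ℓ₁₀ = 1F ∷ 0F ∷ []
pattern ℓ₁₁ = 1F ∷ 1F ∷ []
pattern ℓ₁₂ = 1F ∷ 2F ∷ []
pattern ℓ₂₀ = 2F ∷ 0F ∷ []
pattern ℓ₂₁ = 2F ∷ 1F ∷ []
pattern ℓ₂₂ = 2F ∷ 2F ∷ []

letterOwner : Fin 2 → Player
letterOwner 0F = sys
letterOwner 1F = env

unconstrained : Bowtie × ℕ
unconstrained = ge , 0

firstSteps : Bowtie → ℕ → Loc 2 2 → Cond
firstSteps ⋈ n ℓ₁₀ = (⋈ , n) , unconstrained , unconstrained
firstSteps ⋈ n ℓ₀₁ = unconstrained , (⋈ , n) , unconstrained
firstSteps ⋈ n _   = unconstrained , unconstrained , unconstrained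

G : Game
G = record { nA = 2 ; owner = letterOwner ; B = 2 ; F = firstSteps eq 0 ∷ firstSteps ge 1 ∷ [] }

open Properties G

Cfg : Set
Cfg = Config G

Tr : Set
Tr = Trans G

Accepted : Cfg → Set
Accepted = _⊨F G

s₀ e₀ s₁ e₁ : Cfg → ℕ
s₀ C = proj₁ (C ℓ₀₀)
e₀ C = proj₁ (proj₂ (C ℓ₀₀))
s₁ C = proj₁ (C ℓ₁₀)
e₁ C = proj₁ (proj₂ (C ℓ₀₁))

satisfies-firstSteps : ∀ ⋈ n C → satB ⋈ n (s₁ C) → satB ⋈ n (e₁ C) → ∀ ℓ → satC (firstSteps ⋈ n ℓ) (C ℓ)
satisfies-firstSteps ⋈ n C s₁-ok e₁-ok ℓ₁₀ = s₁-ok , z≤n , z≤n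
satisfies-firstSteps ⋈ n C s₁-ok e₁-ok ℓ₀₁ = z≤n , e₁-ok , z≤n
satisfies-firstSteps ⋈ n C s₁-ok e₁-ok ℓ₀₀ = z≤n , z≤n , z≤n
satisfies-firstSteps ⋈ n C s₁-ok e₁-ok ℓ₀₂ = z≤n , z≤n , z≤n
satisfies-firstSteps ⋈ n C s₁-ok e₁-ok (1F ∷ suc _ ∷ []) = z≤n , z≤n , z≤n
satisfies-firstSteps ⋈ n C s₁-ok e₁-ok (2F ∷ _ ∷ []) = z≤n , z≤n , z≤n

accepted-empty : ∀ C → s₁ C ≡ 0 → e₁ C ≡ 0 → Accepted C
accepted-empty C s₁≡0 e₁≡0 = here (satisfies-firstSteps eq 0 C s₁≡0 e₁≡0)

accepted-occupied : ∀ C → 1 ≤ s₁ C → 1 ≤ e₁ C → Accepted C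
accepted-occupied C 1≤s₁ 1≤e₁ = there (here (satisfies-firstSteps ge 1 C 1≤s₁ 1≤e₁))

accepted⇒balanced : ∀ C → Accepted C → (s₁ C ≡ 0 → e₁ C ≡ 0) × (e₁ C ≡ 0 → s₁ C ≡ 0)
accepted⇒balanced C (here holds) = (λ _ → proj₁ (proj₂ (holds ℓ₀₁))) , (λ _ → proj₁ (holds ℓ₁₀))
accepted⇒balanced C (there (here holds)) =
  (λ s₁≡0 → contradiction s₁≡0 (≢-sym (<⇒≢ (proj₁ (holds ℓ₁₀))))) ,
  (λ e₁≡0 → contradiction e₁≡0 (≢-sym (<⇒≢ (proj₁ (proj₂ (holds ℓ₀₁))))))

module Flows {p τ} (τ-valid : IsTransOf G p τ) where

  private
    up : ∀ ℓ ℓ' → False (ℓ ≼? ℓ') → τ ℓ ℓ' ≡ zeroT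
    up ℓ ℓ' ℓ⋠ℓ' = moves-up {p} {τ} τ-valid (toWitnessFalse ℓ⋠ℓ')

  inflow-ℓ₀₀ : inn G τ ℓ₀₀ ≡ τ ℓ₀₀ ℓ₀₀ +T zeroT
  inflow-ℓ₀₀ rewrite up ℓ₀₁ ℓ₀₀ _ | up ℓ₀₂ ℓ₀₀ _ | up ℓ₁₀ ℓ₀₀ _ | up ℓ₁₁ ℓ₀₀ _ | up ℓ₁₂ ℓ₀₀ _
                   | up ℓ₂₀ ℓ₀₀ _ | up ℓ₂₁ ℓ₀₀ _ | up ℓ₂₂ ℓ₀₀ _ = refl

  inflow-ℓ₁₀ : inn G τ ℓ₁₀ ≡ τ ℓ₀₀ ℓ₁₀ +T (τ ℓ₁₀ ℓ₁₀ +T zeroT)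
  inflow-ℓ₁₀ rewrite up ℓ₀₁ ℓ₁₀ _ | up ℓ₀₂ ℓ₁₀ _ | up ℓ₁₁ ℓ₁₀ _ | up ℓ₁₂ ℓ₁₀ _
                   | up ℓ₂₀ ℓ₁₀ _ | up ℓ₂₁ ℓ₁₀ _ | up ℓ₂₂ ℓ₁₀ _ = refl

  inflow-ℓ₀₁ : inn G τ ℓ₀₁ ≡ τ ℓ₀₀ ℓ₀₁ +T (τ ℓ₀₁ ℓ₀₁ +T zeroT)
  inflow-ℓ₀₁ rewrite up ℓ₀₂ ℓ₀₁ _ | up ℓ₁₀ ℓ₀₁ _ | up ℓ₁₁ ℓ₀₁ _ | up ℓ₁₂ ℓ₀₁ _
                   | up ℓ₂₀ ℓ₀₁ _ | up ℓ₂₁ ℓ₀₁ _ | up ℓ₂₂ ℓ₀₁ _ = refl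

  inflow≤outflow-ℓ₀₀ : inn G τ ℓ₀₀ ≤T out G τ ℓ₀₀
  inflow≤outflow-ℓ₀₀ = subst (_≤T out G τ ℓ₀₀) (sym inflow-ℓ₀₀) (bound , bound , bound)
    where
    bound : ∀ {t r} → t + 0 ≤ t + r
    bound {t} = +-monoʳ-≤ t z≤n

  -- allL lists the locations as ℓ₀₀, ℓ₀₁, ℓ₀₂, ℓ₁₀, …, which fixes the membership proofs below.
  inflow≤outflow-ℓ₀₀ℓ₁₀ : (inn G τ ℓ₀₀ +T inn G τ ℓ₁₀) ≤T (out G τ ℓ₀₀ +T out G τ ℓ₁₀)
  inflow≤outflow-ℓ₀₀ℓ₁₀ =
    subst₂ (λ i₀ i₁ → (i₀ +T i₁) ≤T (out G τ ℓ₀₀ +T out G τ ℓ₁₀)) (sym inflow-ℓ₀₀) (sym inflow-ℓ₁₀)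
      (flow-pair-≤T (τ ℓ₀₀ ℓ₀₀) (τ ℓ₀₀ ℓ₁₀) (τ ℓ₁₀ ℓ₁₀)
        (member-≤T (τ ℓ₀₀) (drop 1 (allL G)) (there (there (here refl))))
        (member-≤T (τ ℓ₁₀) (allL G) (there (there (there (here refl))))))

  inflow≤outflow-ℓ₀₀ℓ₀₁ : (inn G τ ℓ₀₀ +T inn G τ ℓ₀₁) ≤T (out G τ ℓ₀₀ +T out G τ ℓ₀₁)
  inflow≤outflow-ℓ₀₀ℓ₀₁ =
    subst₂ (λ i₀ i₁ → (i₀ +T i₁) ≤T (out G τ ℓ₀₀ +T out G τ ℓ₀₁)) (sym inflow-ℓ₀₀) (sym inflow-ℓ₀₁)
      (flow-pair-≤T (τ ℓ₀₀ ℓ₀₀) (τ ℓ₀₀ ℓ₀₁) (τ ℓ₀₁ ℓ₀₁)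
        (member-≤T (τ ℓ₀₀) (drop 1 (allL G)) (here refl))
        (member-≤T (τ ℓ₀₁) (allL G) (there (here refl))))

  module _ {C} (τ-app : Applicable G τ C) where

    ℓ₀₀-nonincreasing : apply G τ C ℓ₀₀ ≤T C ℓ₀₀
    ℓ₀₀-nonincreasing = drain-≤T (τ-app ℓ₀₀) inflow≤outflow-ℓ₀₀

    ℓ₀₀+ℓ₁₀-nonincreasing : (apply G τ C ℓ₀₀ +T apply G τ C ℓ₁₀) ≤T (C ℓ₀₀ +T C ℓ₁₀)
    ℓ₀₀+ℓ₁₀-nonincreasing = drain₂-≤T (τ-app ℓ₀₀) (τ-app ℓ₁₀) inflow≤outflow-ℓ₀₀ℓ₁₀

    ℓ₀₀+ℓ₀₁-nonincreasing : (apply G τ C ℓ₀₀ +T apply G τ C ℓ₀₁) ≤T (C ℓ₀₀ +T C ℓ₀₁)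
    ℓ₀₀+ℓ₀₁-nonincreasing = drain₂-≤T (τ-app ℓ₀₀) (τ-app ℓ₀₁) inflow≤outflow-ℓ₀₀ℓ₀₁

sys-keeps-e : ∀ {σ} → IsSysTrans G σ → ∀ C ℓ → proj₁ (proj₂ (apply G σ C ℓ)) ≡ proj₁ (proj₂ (C ℓ))
sys-keeps-e {σ} = keeps-foreign {sys} {σ}

env-keeps-s : ∀ {ρ} → IsEnvTrans G ρ → ∀ C ℓ → proj₁ (apply G ρ C ℓ) ≡ proj₁ (C ℓ)
env-keeps-s {ρ} = keeps-foreign {env} {ρ}

idle : Tr
idle _ _ = zeroT

sysAdvance : Tr
sysAdvance = move ℓ₀₀ ℓ₁₀ (1 , 0 , 0)

sysClear : ℕ → Tr
sysClear n = move ℓ₁₀ ℓ₂₀ (n , 0 , 0)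

envAdvance : Tr
envAdvance = move ℓ₀₀ ℓ₀₁ (0 , 1 , 0)

envClear : ℕ → Tr
envClear m = move ℓ₀₁ ℓ₀₂ (0 , m , 0)

idle-valid : IsSysTrans G idle
idle-valid _ _ = refl , λ 0≢0 → ⊥-elim (0≢0 refl)

sysAdvance-valid : IsSysTrans G sysAdvance
sysAdvance-valid = move-valid sys (0F ∷ [] , refl ∷ [] , refl) refl

sysClear-valid : ∀ n → IsSysTrans G (sysClear n)
sysClear-valid n = move-valid sys (0F ∷ [] , refl ∷ [] , refl) refl

envAdvance-valid : IsEnvTrans G envAdvance
envAdvance-valid = move-valid env (1F ∷ [] , refl ∷ [] , refl) refl

envClear-valid : ∀ m → IsEnvTrans G (envClear m)
envClear-valid m = move-valid env (1F ∷ [] , refl ∷ [] , refl) refl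

idle-applicable : ∀ C → Applicable G idle C
idle-applicable C ℓ = zeroT-≤T

sysAdvance-applicable : ∀ C → 1 ≤ s₀ C → Applicable G sysAdvance C
sysAdvance-applicable C 1≤s₀ ℓ₀₀                = 1≤s₀ , z≤n , z≤n
sysAdvance-applicable C _    (0F ∷ suc _ ∷ [])  = zeroT-≤T
sysAdvance-applicable C _    (suc _ ∷ _ ∷ [])   = zeroT-≤T

sysClear-applicable : ∀ C n → n ≤ s₁ C → Applicable G (sysClear n) C
sysClear-applicable C n n≤s₁ ℓ₁₀               = ≤-trans (≤-reflexive (+-identityʳ n)) n≤s₁ , z≤n , z≤n
sysClear-applicable C n _    (0F ∷ _ ∷ [])      = zeroT-≤T
sysClear-applicable C n _    (1F ∷ suc _ ∷ [])  = zeroT-≤T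
sysClear-applicable C n _    (2F ∷ _ ∷ [])      = zeroT-≤T

envAdvance-applicable : ∀ C → 1 ≤ e₀ C → Applicable G envAdvance C
envAdvance-applicable C 1≤e₀ ℓ₀₀               = z≤n , 1≤e₀ , z≤n
envAdvance-applicable C _    (0F ∷ suc _ ∷ []) = zeroT-≤T
envAdvance-applicable C _    (suc _ ∷ _ ∷ [])  = zeroT-≤T

envClear-applicable : ∀ C m → m ≤ e₁ C → Applicable G (envClear m) C
envClear-applicable C m m≤e₁ ℓ₀₁              = z≤n , ≤-trans (≤-reflexive (+-identityʳ m)) m≤e₁ , z≤n
envClear-applicable C m _    ℓ₀₀              = zeroT-≤T
envClear-applicable C m _    ℓ₀₂              = zeroT-≤T
envClear-applicable C m _    (suc _ ∷ _ ∷ []) = zeroT-≤T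

apply-idle : ∀ C → apply G idle C ≈C C
apply-idle C ℓ = cong₂ _,_ (+-identityʳ _) (cong₂ _,_ (+-identityʳ _) (+-identityʳ _))

≡suc⇒>0 : ∀ {x n} → x ≡ suc n → 1 ≤ x
≡suc⇒>0 refl = s≤s z≤n

-- what is left on a location holding c = n tokens once a move takes all n away, as apply computes it
clear-empties : ∀ {c n} → c ≡ n → c ∸ (n + 0) + 0 ≡ 0
clear-empties {n = n} refl = trans (+-identityʳ _) (trans (cong (n ∸_) (+-identityʳ n)) (n∸n≡0 n))

-- System wins when k_e ≤ k_s

-- respondTo (e₁ C) (s₁ C) (s₀ C): cover a token on ℓ₀₁ by one on ℓ₁₀, and clear ℓ₁₀ once ℓ₀₁ is empty.
respondTo : ℕ → ℕ → ℕ → Maybe Tr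
respondTo zero    n       _       = just (sysClear n)
respondTo (suc _) (suc _) _       = just idle
respondTo (suc _) zero    (suc _) = just sysAdvance
respondTo (suc _) zero    zero    = nothing

respond : Cfg → Maybe Tr
respond C = respondTo (e₁ C) (s₁ C) (s₀ C)

Safe : Cfg → Set
Safe C = e₀ C ≤ s₀ C × (s₁ C ≡ 0 → 1 ≤ e₁ C → e₀ C < s₀ C)

respond-cong : ∀ {C C'} → C ≈C C' → respond C ≡ respond C'
respond-cong C≈C' =
  cong₂ (λ e₁ (s₁ , s₀) → respondTo e₁ s₁ s₀) (cong (λ t → proj₁ (proj₂ t)) (C≈C' ℓ₀₁))
        (cong₂ _,_ (cong proj₁ (C≈C' ℓ₁₀)) (cong proj₁ (C≈C' ℓ₀₀)))

Safe-cong : ∀ {C C'} → C ≈C C' → Safe C → Safe C'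
Safe-cong {C} C≈C' with C ℓ₀₀ | C≈C' ℓ₀₀ | C ℓ₁₀ | C≈C' ℓ₁₀ | C ℓ₀₁ | C≈C' ℓ₀₁
... | _ | refl | _ | refl | _ | refl = λ safe → safe

respond-legal : ∀ C {σ} → respond C ≡ just σ → LegalSysMove G C σ
respond-legal C σ-chosen with e₁ C in e₁≡ | s₁ C in s₁≡ | s₀ C in s₀≡
respond-legal C refl | zero  | n     | _ =
  sysClear-valid n , sysClear-applicable C n (≤-reflexive (sym s₁≡)) , accepted-empty _ (clear-empties s₁≡)
                                                          (trans (sys-keeps-e (sysClear-valid n) C ℓ₀₁) e₁≡)
respond-legal C refl | suc _ | suc _ | _ =
  idle-valid , idle-applicable C ,
  accepted-occupied _ (≡suc⇒>0 (trans (cong proj₁ (apply-idle C ℓ₁₀)) s₁≡))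
                      (≡suc⇒>0 (trans (sys-keeps-e idle-valid C ℓ₀₁) e₁≡))
respond-legal C refl | suc _ | zero  | suc _ =
  sysAdvance-valid , sysAdvance-applicable C (≡suc⇒>0 s₀≡) ,
  accepted-occupied _ (m≤n+m 1 (s₁ C)) (≡suc⇒>0 (trans (sys-keeps-e sysAdvance-valid C ℓ₀₁) e₁≡))

respond-defined : ∀ C → Safe C → Σ Tr λ σ → respond C ≡ just σ
respond-defined C (_ , short⇒e₀<s₀) with e₁ C | s₁ C | s₀ C
... | zero  | _     | _     = _ , refl
... | suc _ | suc _ | _     = _ , refl
... | suc _ | zero  | suc _ = _ , refl
... | suc _ | zero  | zero  = contradiction (short⇒e₀<s₀ refl (s≤s z≤n)) n≮0

-- The counts after each answer compute, e.g. s₀ C ∸ 1 + 0 on ℓ₀₀ after sysAdvance.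
respond-preserves : ∀ C {σ} → Safe C → respond C ≡ just σ → Safe (apply G σ C)
respond-preserves C safe σ-chosen with e₁ C | s₁ C | s₀ C
respond-preserves C (e₀≤s₀ , _) refl | zero  | _     | _ = +-monoˡ-≤ 0 e₀≤s₀ , λ _ ()
respond-preserves C (e₀≤s₀ , _) refl | suc _ | suc _ | _ = +-monoˡ-≤ 0 e₀≤s₀ , λ ()
respond-preserves C (_ , short⇒e₀<s₀) refl | suc _ | zero | suc _ =
  +-monoˡ-≤ 0 (≤-pred (short⇒e₀<s₀ refl (s≤s z≤n))) , λ ()

env-preserves : ∀ C {ρ} → IsEnvTrans G ρ → Applicable G ρ C → Safe C → Safe (apply G ρ C)
env-preserves C {ρ} ρ-valid ρ-app (e₀≤s₀ , short⇒e₀<s₀) =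
  subst (e₀ C' ≤_) (sym s₀-kept) (≤-trans e₀-nonincreasing e₀≤s₀) ,
  λ s₁'≡0 1≤e₁' → subst (e₀ C' <_) (sym s₀-kept) (e₀'<s₀ (trans (sym s₁-kept) s₁'≡0) 1≤e₁')
  where
  open Flows {env} {ρ} ρ-valid
  C' = apply G ρ C
  s₀-kept : s₀ C' ≡ s₀ C
  s₀-kept = env-keeps-s ρ-valid C ℓ₀₀
  s₁-kept : s₁ C' ≡ s₁ C
  s₁-kept = env-keeps-s ρ-valid C ℓ₁₀
  e₀-nonincreasing : e₀ C' ≤ e₀ C
  e₀-nonincreasing = proj₁ (proj₂ (ℓ₀₀-nonincreasing ρ-app))
  e-conserved : e₀ C' + e₁ C' ≤ e₀ C + e₁ C
  e-conserved = proj₁ (proj₂ (ℓ₀₀+ℓ₀₁-nonincreasing ρ-app))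
  -- an environment token on ℓ₀₁ either was already there, or has just left ℓ₀₀
  e₀'<s₀ : s₁ C ≡ 0 → 1 ≤ e₁ C' → e₀ C' < s₀ C
  e₀'<s₀ s₁≡0 1≤e₁' with e₁ C ≟ 0
  ... | no e₁≢0  = ≤-<-trans e₀-nonincreasing (short⇒e₀<s₀ s₁≡0 (n≢0⇒n>0 e₁≢0))
  ... | yes e₁≡0 = ≤-trans e₀'<e₀ e₀≤s₀
    where
    e₀'<e₀ : e₀ C' < e₀ C
    e₀'<e₀ = begin
      suc (e₀ C')     ≡⟨ +-comm 1 (e₀ C') ⟩
      e₀ C' + 1       ≤⟨ +-monoʳ-≤ (e₀ C') 1≤e₁' ⟩
      e₀ C' + e₁ C'   ≤⟨ e-conserved ⟩
      e₀ C + e₁ C     ≡⟨ cong (e₀ C +_) e₁≡0 ⟩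
      e₀ C + 0        ≡⟨ +-identityʳ (e₀ C) ⟩
      e₀ C            ∎
      where open ≤-Reasoning

system-wins : ∀ k → proj₁ (proj₂ k) ≤ proj₁ k → Win G k
system-wins k e≤s = Positional.positional-wins (Cinit G k) respond Safe respond-cong Safe-cong
  respond-legal respond-defined respond-preserves env-preserves (e≤s , λ _ ())

-- System loses when k_s < k_e

module SystemLoses (k : Tri) (s<e : proj₁ k < proj₁ (proj₂ k))
                   {f : PreStrategy G} (f-wins : IsWinningStrategy G (Cinit G k) f) where

  open ForcedReplies f-wins

  end : List Tr → Cfg
  end = lastConf G (Cinit G k)

  end-++ : ∀ ts ρ σ → end (ts ++ ρ ∷ σ ∷ []) ≡ apply G σ (apply G ρ (end ts))
  end-++ ts ρ σ = lastConf-++ (Cinit G k) ts (ρ ∷ σ ∷ [])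

  advance-round : ∀ {ts} → EnvToMove ts → s₁ (end ts) ≡ 0 → 1 ≤ e₀ (end ts) →
    Σ Tr λ σ → let D = end ts ; D' = end (ts ++ envAdvance ∷ σ ∷ []) in
      EnvToMove (ts ++ envAdvance ∷ σ ∷ []) × 1 ≤ s₁ D' × s₀ D' < s₀ D × e₀ D' ≡ e₀ D ∸ 1
  advance-round {ts} ts-env s₁≡0 1≤e₀ =
    σ , env' , subst (λ D' → 1 ≤ s₁ D' × s₀ D' < s₀ D × e₀ D' ≡ e₀ D ∸ 1) (sym (end-++ ts envAdvance σ))
                     (1≤s₁' , s₀'<s₀ , e₀-dropped)
    where
    D  = end ts
    D₁ = apply G envAdvance D
    s₁₁≡0 : s₁ D₁ ≡ 0
    s₁₁≡0 = trans (env-keeps-s envAdvance-valid D ℓ₁₀) s₁≡0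
    1≤e₁₁ : 1 ≤ e₁ D₁
    1≤e₁₁ = m≤n+m 1 (e₁ D)
    reply = forced-reply ts-env envAdvance-valid (envAdvance-applicable D 1≤e₀)
              (λ acc → <⇒≢ 1≤e₁₁ (sym (proj₁ (accepted⇒balanced D₁ acc) s₁₁≡0)))
    σ = proj₁ reply
    σ-legal = proj₁ (proj₂ reply)
    env' = proj₂ (proj₂ reply)
    D₂ = apply G σ D₁
    1≤e₁₂ : 1 ≤ e₁ D₂
    1≤e₁₂ = ≤-trans 1≤e₁₁ (≤-reflexive (sym (sys-keeps-e (proj₁ σ-legal) D₁ ℓ₀₁)))
    1≤s₁' : 1 ≤ s₁ D₂
    1≤s₁' = n≢0⇒n>0 λ s₁₂≡0 → <⇒≢ 1≤e₁₂ (sym (proj₁ (accepted⇒balanced D₂ (proj₂ (proj₂ σ-legal))) s₁₂≡0))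
    s₀'<s₀ : s₀ D₂ < s₀ D
    s₀'<s₀ = begin
      suc (s₀ D₂)     ≡⟨ +-comm 1 (s₀ D₂) ⟩
      s₀ D₂ + 1       ≤⟨ +-monoʳ-≤ (s₀ D₂) 1≤s₁' ⟩
      s₀ D₂ + s₁ D₂   ≤⟨ proj₁ (Flows.ℓ₀₀+ℓ₁₀-nonincreasing {sys} {σ} (proj₁ σ-legal) (proj₁ (proj₂ σ-legal))) ⟩
      s₀ D₁ + s₁ D₁   ≡⟨ cong₂ _+_ (env-keeps-s envAdvance-valid D ℓ₀₀) s₁₁≡0 ⟩
      s₀ D + 0        ≡⟨ +-identityʳ (s₀ D) ⟩
      s₀ D            ∎
      where open ≤-Reasoning
    e₀-dropped : e₀ D₂ ≡ e₀ D ∸ 1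
    e₀-dropped = trans (sys-keeps-e (proj₁ σ-legal) D₁ ℓ₀₀) (+-identityʳ (e₀ D ∸ 1))

  clear-round : ∀ {ts} → EnvToMove ts → 1 ≤ s₁ (end ts) →
    Σ Tr λ σ → let D = end ts ; D' = end (ts ++ envClear (e₁ D) ∷ σ ∷ []) in
      EnvToMove (ts ++ envClear (e₁ D) ∷ σ ∷ []) × s₁ D' ≡ 0 × s₀ D' ≤ s₀ D × e₀ D' ≡ e₀ D
  clear-round {ts} ts-env 1≤s₁ =
    σ , env' , subst (λ D' → s₁ D' ≡ 0 × s₀ D' ≤ s₀ D × e₀ D' ≡ e₀ D) (sym (end-++ ts ρ σ))
                     (proj₂ (accepted⇒balanced D₂ (proj₂ (proj₂ σ-legal))) e₁₂≡0 , s₀-nonincreasing , e₀-kept)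
    where
    D  = end ts
    ρ  = envClear (e₁ D)
    D₁ = apply G ρ D
    e₁₁≡0 : e₁ D₁ ≡ 0
    e₁₁≡0 = clear-empties {e₁ D} refl
    1≤s₁₁ : 1 ≤ s₁ D₁
    1≤s₁₁ = ≤-trans 1≤s₁ (≤-reflexive (sym (env-keeps-s (envClear-valid (e₁ D)) D ℓ₁₀)))
    reply = forced-reply ts-env (envClear-valid (e₁ D)) (envClear-applicable D (e₁ D) ≤-refl)
              (λ acc → <⇒≢ 1≤s₁₁ (sym (proj₂ (accepted⇒balanced D₁ acc) e₁₁≡0)))
    σ = proj₁ reply
    σ-legal = proj₁ (proj₂ reply)
    env' = proj₂ (proj₂ reply)
    D₂ = apply G σ D₁
    e₁₂≡0 : e₁ D₂ ≡ 0
    e₁₂≡0 = trans (sys-keeps-e (proj₁ σ-legal) D₁ ℓ₀₁) e₁₁≡0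
    s₀-nonincreasing : s₀ D₂ ≤ s₀ D
    s₀-nonincreasing = ≤-trans (proj₁ (Flows.ℓ₀₀-nonincreasing {sys} {σ} (proj₁ σ-legal) (proj₁ (proj₂ σ-legal))))
                               (≤-reflexive (env-keeps-s (envClear-valid (e₁ D)) D ℓ₀₀))
    e₀-kept : e₀ D₂ ≡ e₀ D
    e₀-kept = trans (sys-keeps-e (proj₁ σ-legal) D₁ ℓ₀₀) (+-identityʳ (e₀ D))

  record Position : Set where
    field
      play      : List Tr
      envToMove : EnvToMove play
      s₁-empty  : s₁ (end play) ≡ 0
      s₀<e₀     : s₀ (end play) < e₀ (end play)

  open Position

  opening-position : Position
  opening-position =
    let σ , (σ-valid , σ-applicable , σ-accepted) , env₁ = opening
        C₀ = Cinit G k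
    in record
      { play = σ ∷ [] ; envToMove = env₁
      ; s₁-empty = proj₂ (accepted⇒balanced (apply G σ C₀) σ-accepted) (sys-keeps-e σ-valid C₀ ℓ₀₁)
      ; s₀<e₀ = ≤-<-trans (proj₁ (Flows.ℓ₀₀-nonincreasing {sys} {σ} σ-valid σ-applicable))
                          (subst (proj₁ k <_) (sym (sys-keeps-e σ-valid C₀ ℓ₀₀)) s<e)
      }

  round : (P : Position) → Σ Position λ P' → s₀ (end (play P')) < s₀ (end (play P))
  round P =
    let σ₁ , env₂ , 1≤s₁₂ , s₀₂<s₀ , e₀₂≡e₀∸1 =
          advance-round (envToMove P) (s₁-empty P) (≤-trans (s≤s z≤n) (s₀<e₀ P))
        σ₂ , env₄ , s₁₄≡0 , s₀₄≤s₀₂ , e₀₄≡e₀₂ = clear-round env₂ 1≤s₁₂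
        ts₂ = play P ++ envAdvance ∷ σ₁ ∷ []
        ts₄ = ts₂ ++ envClear (e₁ (end ts₂)) ∷ σ₂ ∷ []
        s₀₄<s₀ = ≤-<-trans s₀₄≤s₀₂ s₀₂<s₀
        s₀₄<e₀₄ = subst (s₀ (end ts₄) <_) (sym (trans e₀₄≡e₀₂ e₀₂≡e₀∸1))
                        (∸-monoˡ-≤ 1 (≤-trans (s≤s s₀₄<s₀) (s₀<e₀ P)))
    in record { play = ts₄ ; envToMove = env₄ ; s₁-empty = s₁₄≡0 ; s₀<e₀ = s₀₄<e₀₄ } , s₀₄<s₀

  no-position : ∀ n (P : Position) → s₀ (end (play P)) ≤ n → ⊥
  no-position zero    P s₀≤0 = n≮0 (≤-trans (proj₂ (round P)) s₀≤0)
  no-position (suc n) P s₀≤n = no-position n (proj₁ (round P)) (≤-pred (≤-trans (proj₂ (round P)) s₀≤n))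

  f-loses : ⊥
  f-loses = no-position _ opening-position ≤-refl

system-loses : ∀ k → proj₁ k < proj₁ (proj₂ k) → ¬ Win G k
system-loses k s<e (_ , f-wins) = SystemLoses.f-loses k s<e f-wins

lemma3 : Σ Game λ G → ¬ Σ Tri λ k₀ → IsCutoff (Win G) Allℕ Allℕ Only0 k₀
lemma3 = G , λ where
  ((s , e , _) , (_ , _ , se≡0) , inj₁ all-win) →
    system-loses (s , suc (s + e) , 0) (s≤s (m≤m+n s e))
      (all-win s (suc (s + e)) 0 tt tt refl ≤-refl (≤-trans (m≤n+m e s) (n≤1+n _)) (≤-reflexive se≡0))
  ((s , e , _) , (_ , _ , se≡0) , inj₂ all-lose) →
    all-lose (s + e) e 0 tt tt refl (m≤m+n s e) ≤-refl (≤-reflexive se≡0)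
      (system-wins (s + e , e , 0) (m≤n+m e s))
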